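{- (a) For the complete graph $K_n$, $N_{sp}(K_n)=n$. (b) For the complete bipartite graph $K_{n,m}$ with $\min\{n,m\}\geq 2$, $N_{sp}(K_{n,m})=nm$. (c) For the star graph $K_{1,n}$, $N_{sp}(K_{1,n})=n+1$.
   Context: All graphs are finite, simple, undirected. For $S\subseteq V(G)$, $\overline{S}=V(G)\setminus S$ and $N(v)$ denotes the open neighbourhood of $v$. A set $S$ is a super dominating set of $G$ if every vertex of $\overline{S}$ has a neighbour in $S$ and for every $u\in\overline{S}$ there is $v\in S$ with $N(v)\cap\overline{S}=\{u\}$. The super domination number $\gamma_{sp}(G)$ is the minimum cardinality of a super dominating set of $G$. $N_{sp}(G)$ denotes the number of super dominating sets of $G$ of cardinality $\gamma_{sp}(G)$. In (a), $n\geq 2$ is implicit for $K_n$ to be considered; $K_{1,n}$ is the star with $n$ leaves. -}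

module Defs where

open import Data.Nat using (ℕ; _+_; _≤_)
open import Data.Fin using (Fin; splitAt)
open import Data.Fin.Subset using (Subset; _∈_; _∉_; ∣_∣)
open import Data.Bool using (Bool; true; false)
open import Data.Sum using (inj₁; inj₂)
open import Data.Product using (Σ; ∃; _×_)
open import Relation.Binary.PropositionalEquality using (_≡_; _≢_)
open import Relation.Nullary using (¬_)
open import Function.Definitions using (Injective)

record Graph (N : ℕ) : Set₁ where
  field
    Adj   : Fin N → Fin N → Set
    sym   : ∀ {u v} → Adj u v → Adj v u
    irrfl : ∀ {u} → ¬ Adj u u
open Graph public

IsSuperDominating : ∀ {N} → Graph N → Subset N → Set
IsSuperDominating {N} G S =
  (∀ (u : Fin N) → u ∉ S → ∃ λ v → v ∈ S × Adj G v u)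
  × (∀ (u : Fin N) → u ∉ S →
       ∃ λ v → v ∈ S × Adj G v u
             × (∀ (w : Fin N) → w ∉ S → Adj G v w → w ≡ u))

IsMinSuperDominating : ∀ {N} → Graph N → Subset N → Set
IsMinSuperDominating {N} G S =
  IsSuperDominating G S × (∀ (T : Subset N) → IsSuperDominating G T → ∣ S ∣ ≤ ∣ T ∣)

-- "Exactly k subsets satisfy P": an injective enumeration Fin k → Subset N
-- whose image is exactly the subsets satisfying P.
CountIs : ∀ {N} → (Subset N → Set) → ℕ → Set
CountIs {N} P k =
  Σ (Fin k → Subset N) λ f →
    Injective _≡_ _≡_ f
    × (∀ (S : Subset N) → (P S → ∃ λ i → f i ≡ S) × (∀ i → f i ≡ S → P S))

Nsp≡ : ∀ {N} → Graph N → ℕ → Set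
Nsp≡ G k = CountIs (IsMinSuperDominating G) k

K : (n : ℕ) → Graph n
K n = record { Adj = λ i j → i ≢ j ; sym = λ p q → p (Relation.Binary.PropositionalEquality.sym q) ; irrfl = λ p → p Relation.Binary.PropositionalEquality.refl }

-- Side of a vertex of Fin (n + m): first n vertices form one part, last m the other.
side : ∀ n {m} → Fin (n + m) → Bool
side n i with splitAt n i
... | inj₁ _ = true
... | inj₂ _ = false

Kb : (n m : ℕ) → Graph (n + m)
Kb n m = record { Adj = λ i j → side n i ≢ side n j ; sym = λ p q → p (Relation.Binary.PropositionalEquality.sym q) ; irrfl = λ p → p Relation.Binary.PropositionalEquality.refl }

-- If S is super dominating and u, w ∉ S, the private neighbour v ∈ S of u is not adjacent to w.
-- In K_n every v ∈ S is adjacent to every w ∉ S, and in K_{n,m} to every w ∉ S on u's side, so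
-- at most one vertex (resp. one vertex per side) lies outside S. Conversely deleting one vertex
-- (resp. one vertex from each side) leaves a super dominating set as soon as the deleted vertex
-- keeps a neighbour. The minimum super dominating sets are therefore the complements of the n
-- singletons of K_n, of the n·m cross pairs of K_{n,m}, and of the n + 1 singletons of K_{1,n}
-- (a leaf and the centre cannot both be outside, as the leaf's only neighbour is the centre).
-- For K_{1,0} the only super dominating set is the whole vertex set.
module Submission where

open import Defs hiding (sym)
open import Data.Nat using (ℕ; zero; suc; _≤_; _*_; _+_; s≤s; z≤n)
open import Data.Nat.Properties
  using (+-comm; +-suc; +-cancelˡ-≡; +-cancelˡ-≤; +-cancelʳ-≤; +-monoʳ-≤; +-monoˡ-≤; ≮⇒≥; ≤-reflexive;
         module ≤-Reasoning)
open import Data.Fin using (Fin; zero; suc; splitAt; inject≤; punchIn; combine; remQuot; _↑ˡ_; _↑ʳ_)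
open import Data.Fin.Properties
  using (suc-injective; <-irrefl; pigeonhole; inject≤-injective; punchInᵢ≢i; ↑ˡ-injective;
         ↑ʳ-injective; splitAt-↑ˡ; splitAt-↑ʳ; splitAt⁻¹-↑ˡ; splitAt⁻¹-↑ʳ; remQuot-combine;
         combine-remQuot; 2↔Bool)
open import Data.Fin.Subset using (Subset; _∈_; _∉_; ∣_∣; ∁; ⁅_⁆; _∪_; ⊥)
open import Data.Fin.Subset.Properties
  using (_∈?_; ⊆-antisym; ∉⊥; ∣⊥∣≡0; ∣⁅x⁆∣≡1; x∈⁅x⁆; x∈⁅y⁆⇒x≡y; x≢y⇒x∉⁅y⁆; x∈p∪q⁻; x∈p∪q⁺;
         ∪-identityˡ; ∪-identityʳ; x∈p⇒x∉∁p; x∈∁p⇒x∉p; x∉∁p⇒x∈p; x∉p⇒x∈∁p)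
open import Data.Vec using ([]; _∷_; here; there)
open import Data.Bool using (true; false)
open import Data.Bool.Properties using (¬-not)
open import Data.Sum using (_⊎_; inj₁; inj₂; [_,_]′)
import Data.Sum as Sum
open import Data.Product using (∃; _×_; _,_; proj₁; proj₂; uncurry)
open import Data.Empty using (⊥-elim)
open import Function using (_∘_; case_of_)
open import Function.Bundles using (Inverse)
open import Function.Definitions using (Injective)
open import Relation.Binary.PropositionalEquality
open import Relation.Nullary using (¬_)
open import Relation.Nullary.Decidable using (decidable-stable)

∣p∣+∣∁p∣≡n : ∀ {n} (p : Subset n) → ∣ p ∣ + ∣ ∁ p ∣ ≡ n
∣p∣+∣∁p∣≡n []          = refl
∣p∣+∣∁p∣≡n (true ∷ p)  = cong suc (∣p∣+∣∁p∣≡n p)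
∣p∣+∣∁p∣≡n (false ∷ p) = trans (+-suc ∣ p ∣ ∣ ∁ p ∣) (cong suc (∣p∣+∣∁p∣≡n p))

module _ {n r c : ℕ} (n≡r+c : n ≡ r + c) (p : Subset n) where
  open ≤-Reasoning

  ∣∁p∣≤r⇒c≤∣p∣ : ∣ ∁ p ∣ ≤ r → c ≤ ∣ p ∣
  ∣∁p∣≤r⇒c≤∣p∣ ∣∁p∣≤r = +-cancelˡ-≤ r c ∣ p ∣ (begin
    r + c             ≡⟨ sym (trans (∣p∣+∣∁p∣≡n p) n≡r+c) ⟩
    ∣ p ∣ + ∣ ∁ p ∣   ≤⟨ +-monoʳ-≤ ∣ p ∣ ∣∁p∣≤r ⟩
    ∣ p ∣ + r         ≡⟨ +-comm ∣ p ∣ r ⟩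
    r + ∣ p ∣         ∎)

  ∣p∣≤c⇒r≤∣∁p∣ : ∣ p ∣ ≤ c → r ≤ ∣ ∁ p ∣
  ∣p∣≤c⇒r≤∣∁p∣ ∣p∣≤c = +-cancelʳ-≤ c r ∣ ∁ p ∣ (begin
    r + c             ≡⟨ sym (trans (∣p∣+∣∁p∣≡n p) n≡r+c) ⟩
    ∣ p ∣ + ∣ ∁ p ∣   ≤⟨ +-monoˡ-≤ ∣ ∁ p ∣ ∣p∣≤c ⟩
    c + ∣ ∁ p ∣       ≡⟨ +-comm c ∣ ∁ p ∣ ⟩
    ∣ ∁ p ∣ + c       ∎)

  ∣p∣≡r⇒∣∁p∣≡c : ∣ p ∣ ≡ r → ∣ ∁ p ∣ ≡ c
  ∣p∣≡r⇒∣∁p∣≡c ∣p∣≡r = +-cancelˡ-≡ r ∣ ∁ p ∣ c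
    (trans (cong (_+ ∣ ∁ p ∣) (sym ∣p∣≡r)) (trans (∣p∣+∣∁p∣≡n p) n≡r+c))

members : ∀ {n} (p : Subset n) → Fin ∣ p ∣ → Fin n
members (true ∷ p)  zero    = zero
members (true ∷ p)  (suc i) = suc (members p i)
members (false ∷ p) i       = suc (members p i)

members-∈ : ∀ {n} (p : Subset n) i → members p i ∈ p
members-∈ (true ∷ p)  zero    = here
members-∈ (true ∷ p)  (suc i) = there (members-∈ p i)
members-∈ (false ∷ p) i       = there (members-∈ p i)

members-injective : ∀ {n} (p : Subset n) → Injective _≡_ _≡_ (members p)
members-injective (true ∷ p)  {zero}  {zero}  _ = refl
members-injective (true ∷ p)  {suc i} {suc j} e = cong suc (members-injective p (suc-injective e))
members-injective (false ∷ p)                 e = members-injective p (suc-injective e)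

∣p∣≤#colours : ∀ {n r} (p : Subset n) (κ : Fin n → Fin r) →
  (∀ {x y} → x ∈ p → y ∈ p → κ x ≡ κ y → x ≡ y) → ∣ p ∣ ≤ r
∣p∣≤#colours p κ κ-inj = ≮⇒≥ λ r<∣p∣ →
  let (i , j , i<j , κi≡κj) = pigeonhole r<∣p∣ (κ ∘ members p)
  in <-irrefl (members-injective p (κ-inj (members-∈ p i) (members-∈ p j) κi≡κj)) i<j

module _ {n k} (p : Subset n) (k≤∣p∣ : k ≤ ∣ p ∣) where

  pick : Fin k → Fin n
  pick i = members p (inject≤ i k≤∣p∣)

  pick-∈ : ∀ i → pick i ∈ p
  pick-∈ i = members-∈ p (inject≤ i k≤∣p∣)

  pick-injective : Injective _≡_ _≡_ pick
  pick-injective e = inject≤-injective k≤∣p∣ k≤∣p∣ _ _ (members-injective p e)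

≡∁-intro : ∀ {n} {S D : Subset n} → (∀ {x} → x ∉ S → x ∈ D) → (∀ {x} → x ∈ D → x ∉ S) → S ≡ ∁ D
≡∁-intro {S = S} ∉S⇒∈D ∈D⇒∉S = ⊆-antisym
  (λ x∈S → x∉p⇒x∈∁p (λ x∈D → ∈D⇒∉S x∈D x∈S))
  (λ {x} x∈∁D → decidable-stable (x ∈? S) (x∈∁p⇒x∉p x∈∁D ∘ ∉S⇒∈D))

x∈⁅y⁆∪⁅z⁆⇒ : ∀ {n} {x y z : Fin n} → x ∈ ⁅ y ⁆ ∪ ⁅ z ⁆ → x ≡ y ⊎ x ≡ z
x∈⁅y⁆∪⁅z⁆⇒ {y = y} {z} = Sum.map (x∈⁅y⁆⇒x≡y y) (x∈⁅y⁆⇒x≡y z) ∘ x∈p∪q⁻ ⁅ y ⁆ ⁅ z ⁆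

⇒x∈⁅y⁆∪⁅z⁆ : ∀ {n} {x y z : Fin n} → x ≡ y ⊎ x ≡ z → x ∈ ⁅ y ⁆ ∪ ⁅ z ⁆
⇒x∈⁅y⁆∪⁅z⁆ (inj₁ refl) = x∈p∪q⁺ (inj₁ (x∈⁅x⁆ _))
⇒x∈⁅y⁆∪⁅z⁆ (inj₂ refl) = x∈p∪q⁺ (inj₂ (x∈⁅x⁆ _))

∣⁅x⁆∪⁅y⁆∣≡2 : ∀ {n} {x y : Fin n} → x ≢ y → ∣ ⁅ x ⁆ ∪ ⁅ y ⁆ ∣ ≡ 2
∣⁅x⁆∪⁅y⁆∣≡2 {x = zero}  {zero}  x≢y = ⊥-elim (x≢y refl)
∣⁅x⁆∪⁅y⁆∣≡2 {x = zero}  {suc y} _   rewrite ∪-identityˡ ⁅ y ⁆ = cong suc (∣⁅x⁆∣≡1 y)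
∣⁅x⁆∪⁅y⁆∣≡2 {x = suc x} {zero}  _   rewrite ∪-identityʳ ⁅ x ⁆ = cong suc (∣⁅x⁆∣≡1 x)
∣⁅x⁆∪⁅y⁆∣≡2 {x = suc x} {suc y} x≢y = ∣⁅x⁆∪⁅y⁆∣≡2 (x≢y ∘ cong suc)

module _ {N} (G : Graph N) where

  private-neighbours⇒IsSuperDominating : ∀ {S} →
    (∀ u → u ∉ S → ∃ λ v → v ∈ S × Adj G v u × (∀ w → w ∉ S → Adj G v w → w ≡ u)) →
    IsSuperDominating G S
  private-neighbours⇒IsSuperDominating has-private =
    (λ u u∉S → let (v , v∈S , vu , _) = has-private u u∉S in v , v∈S , vu) , has-private

  -- The private neighbour of u would also be adjacent to w.
  N∩S-⊆⇒≡ : ∀ {S u w} → IsSuperDominating G S → u ∉ S → w ∉ S →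
    (∀ {v} → v ∈ S → Adj G v u → Adj G v w) → u ≡ w
  N∩S-⊆⇒≡ (_ , has-private) u∉S w∉S N∩S-⊆ =
    let (v , v∈S , vu , unique) = has-private _ u∉S in sym (unique _ w∉S (N∩S-⊆ v∈S vu))

  IsSuperDominating-∁⁅⁆ : ∀ {u v} → Adj G v u → IsSuperDominating G (∁ ⁅ u ⁆)
  IsSuperDominating-∁⁅⁆ {u} {v} vu = private-neighbours⇒IsSuperDominating λ x x∉ →
    let x≡u = outside x∉ in
    v , x∉p⇒x∈∁p (x≢y⇒x∉⁅y⁆ λ { refl → irrfl G vu }) , subst (Adj G v) (sym x≡u) vu ,
    λ w w∉ _ → trans (outside w∉) (sym x≡u)
    where
    outside : ∀ {x} → x ∉ ∁ ⁅ u ⁆ → x ≡ u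
    outside = x∈⁅y⁆⇒x≡y u ∘ x∉∁p⇒x∈p

  Nsp≡-intro : ∀ {k c} (f : Fin k → Subset N) → Fin k → Injective _≡_ _≡_ f →
    (∀ i → IsSuperDominating G (f i)) → (∀ i → ∣ f i ∣ ≡ c) →
    (∀ T → IsSuperDominating G T → c ≤ ∣ T ∣) →
    (∀ S → IsSuperDominating G S → ∣ S ∣ ≤ c → ∃ λ i → f i ≡ S) →
    Nsp≡ G k
  Nsp≡-intro f i₀ f-inj f-sd ∣f∣≡c c≤ ≤c⇒∈f = f , f-inj , λ S →
    (λ (sd , minimal) → ≤c⇒∈f S sd (subst (∣ S ∣ ≤_) (∣f∣≡c i₀) (minimal (f i₀) (f-sd i₀)))) ,
    (λ { i refl → f-sd i , λ T sd → subst (_≤ ∣ T ∣) (sym (∣f∣≡c i)) (c≤ T sd) })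

Nsp≡-edgeless : ∀ {N} (G : Graph N) → (∀ {u v} → ¬ Adj G u v) → Nsp≡ G 1
Nsp≡-edgeless {N} G edgeless =
  Nsp≡-intro G (λ _ → ∁ ⊥) zero (λ { {zero} {zero} _ → refl ; {suc ()} ; {_} {suc ()} })
    (λ _ → sd) (λ _ → ∣∁⊥∣≡N)
    (λ T sdT → subst (λ X → N ≤ ∣ X ∣) (sym (only T sdT)) (≤-reflexive (sym ∣∁⊥∣≡N)))
    (λ S sdS _ → zero , sym (only S sdS))
  where
  only : ∀ T → IsSuperDominating G T → T ≡ ∁ ⊥
  only T (dominating , _) = ≡∁-intro
    (λ x∉T → let (_ , _ , adj) = dominating _ x∉T in ⊥-elim (edgeless adj))
    (λ x∈⊥ → ⊥-elim (∉⊥ x∈⊥))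
  ∣∁⊥∣≡N : ∣ ∁ (⊥ {N}) ∣ ≡ N
  ∣∁⊥∣≡N = ∣p∣≡r⇒∣∁p∣≡c refl ⊥ (∣⊥∣≡0 N)
  sd : IsSuperDominating G (∁ ⊥)
  sd = private-neighbours⇒IsSuperDominating G λ u u∉ → ⊥-elim (u∉ (x∉p⇒x∈∁p ∉⊥))

AtMostOneOutside : ∀ {N} → Graph N → Set
AtMostOneOutside {N} G = ∀ T → IsSuperDominating G T → ∀ {u w : Fin N} → u ∉ T → w ∉ T → u ≡ w

Nsp≡-coSingletons : ∀ {N} (G : Graph (suc N)) → (∀ u → ∃ λ v → Adj G v u) → AtMostOneOutside G →
  Nsp≡ G (suc N)
Nsp≡-coSingletons {N} G neighbour atMostOneOutside =
  Nsp≡-intro G (λ u → ∁ ⁅ u ⁆) zero ∁⁅⁆-injective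
    (λ u → IsSuperDominating-∁⁅⁆ G (proj₂ (neighbour u)))
    (λ u → ∣p∣≡r⇒∣∁p∣≡c refl ⁅ u ⁆ (∣⁅x⁆∣≡1 u))
    lower upper
  where
  ∁⁅⁆-injective : Injective _≡_ _≡_ (λ (u : Fin (suc N)) → ∁ ⁅ u ⁆)
  ∁⁅⁆-injective {u} {v} e =
    x∈⁅y⁆⇒x≡y v (x∉∁p⇒x∈p (subst (u ∉_) e (x∈p⇒x∉∁p (x∈⁅x⁆ u))))
  lower : ∀ T → IsSuperDominating G T → N ≤ ∣ T ∣
  lower T sdT = ∣∁p∣≤r⇒c≤∣p∣ refl T (∣p∣≤#colours (∁ T) (λ _ → zero {0})
    λ x∈ y∈ _ → atMostOneOutside T sdT (x∈∁p⇒x∉p x∈) (x∈∁p⇒x∉p y∈))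
  upper : ∀ S → IsSuperDominating G S → ∣ S ∣ ≤ N → ∃ λ u → ∁ ⁅ u ⁆ ≡ S
  upper S sdS ∣S∣≤N = u , sym (≡∁-intro
      (λ x∉S → subst (_∈ ⁅ u ⁆) (sym (atMostOneOutside S sdS x∉S u∉S)) (x∈⁅x⁆ u))
      (λ x∈⁅u⁆ → subst (_∉ S) (sym (x∈⁅y⁆⇒x≡y u x∈⁅u⁆)) u∉S))
    where
    1≤∣∁S∣ : 1 ≤ ∣ ∁ S ∣
    1≤∣∁S∣ = ∣p∣≤c⇒r≤∣∁p∣ refl S ∣S∣≤N
    u : Fin (suc N)
    u = pick (∁ S) 1≤∣∁S∣ zero
    u∉S : u ∉ S
    u∉S = x∈∁p⇒x∉p (pick-∈ (∁ S) 1≤∣∁S∣ zero)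

Nsp≡-complete : ∀ n → 2 ≤ n → Nsp≡ (K n) n
Nsp≡-complete (suc (suc n)) (s≤s (s≤s z≤n)) = Nsp≡-coSingletons (K _) neighbour atMostOneOutside
  where
  neighbour : ∀ u → ∃ λ v → Adj (K _) v u
  neighbour u = punchIn u zero , punchInᵢ≢i u zero
  atMostOneOutside : AtMostOneOutside (K _)
  atMostOneOutside T sdT u∉T w∉T =
    N∩S-⊆⇒≡ (K _) sdT u∉T w∉T λ v∈T _ v≡w → w∉T (subst (_∈ T) v≡w v∈T)

side-↑ˡ : ∀ n {m} (i : Fin n) → side n (i ↑ˡ m) ≡ true
side-↑ˡ n {m} i rewrite splitAt-↑ˡ n i m = refl

side-↑ʳ : ∀ n {m} (j : Fin m) → side n (n ↑ʳ j) ≡ false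
side-↑ʳ n {m} j rewrite splitAt-↑ʳ n m j = refl

side-↑ˡ≢side-↑ʳ : ∀ {n m} (i : Fin n) (j : Fin m) → side n (i ↑ˡ m) ≢ side n (n ↑ʳ j)
side-↑ˡ≢side-↑ʳ {n} i j e with () ← trans (sym (side-↑ˡ n i)) (trans e (side-↑ʳ n j))

↑ˡ≢↑ʳ : ∀ {n m} (i : Fin n) (j : Fin m) → i ↑ˡ m ≢ n ↑ʳ j
↑ˡ≢↑ʳ {n} i j = side-↑ˡ≢side-↑ʳ i j ∘ cong (side n)

data Part (n m : ℕ) : Fin (n + m) → Set where
  left  : (i : Fin n) → Part n m (i ↑ˡ m)
  right : (j : Fin m) → Part n m (n ↑ʳ j)

part : ∀ n {m} (x : Fin (n + m)) → Part n m x
part n {m} x with splitAt n {m} x in eq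
... | inj₁ i = subst (Part n m) (splitAt⁻¹-↑ˡ eq) (left i)
... | inj₂ j = subst (Part n m) (splitAt⁻¹-↑ʳ eq) (right j)

module Bipartite (n m : ℕ) where

  one-outside-per-side : ∀ {T u w} → IsSuperDominating (Kb n m) T → u ∉ T → w ∉ T →
    side n u ≡ side n w → u ≡ w
  one-outside-per-side sdT u∉T w∉T su≡sw =
    N∩S-⊆⇒≡ (Kb n m) sdT u∉T w∉T λ _ vu sv≡sw → vu (trans sv≡sw (sym su≡sw))

  ∣∁T∣≤2 : ∀ {T} → IsSuperDominating (Kb n m) T → ∣ ∁ T ∣ ≤ 2
  ∣∁T∣≤2 {T} sdT = ∣p∣≤#colours (∁ T) (from ∘ side n) λ x∈ y∈ same →
    one-outside-per-side sdT (x∈∁p⇒x∉p x∈) (x∈∁p⇒x∉p y∈) (from-injective same)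
    where
    open Inverse 2↔Bool using (to; from; strictlyInverseˡ)
    from-injective : ∀ {a b} → from a ≡ from b → a ≡ b
    from-injective {a} {b} e =
      trans (sym (strictlyInverseˡ a)) (trans (cong to e) (strictlyInverseˡ b))

  -- Every outside neighbour of v lies on the side opposite to v, i.e. on u's side.
  IsSuperDominating-intro : ∀ {S} →
    (∀ {x} → x ∉ S → ∃ λ v → v ∈ S × side n v ≢ side n x) →
    (∀ {u w} → u ∉ S → w ∉ S → side n u ≡ side n w → u ≡ w) →
    IsSuperDominating (Kb n m) S
  IsSuperDominating-intro opposite one-per-side =
    private-neighbours⇒IsSuperDominating (Kb n m) λ u u∉S →
      let (v , v∈S , vu) = opposite u∉S in
      v , v∈S , vu , λ w w∉S vw →
        one-per-side w∉S u∉S (trans (¬-not (vw ∘ sym)) (sym (¬-not (vu ∘ sym))))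

  coPair : Fin n → Fin m → Subset (n + m)
  coPair i j = ∁ (⁅ i ↑ˡ m ⁆ ∪ ⁅ n ↑ʳ j ⁆)

  ∉coPair⇒ : ∀ {i : Fin n} {j : Fin m} {x} → x ∉ coPair i j → x ≡ i ↑ˡ m ⊎ x ≡ n ↑ʳ j
  ∉coPair⇒ = x∈⁅y⁆∪⁅z⁆⇒ ∘ x∉∁p⇒x∈p

  ⇒∉coPair : ∀ {i : Fin n} {j : Fin m} {x} → x ≡ i ↑ˡ m ⊎ x ≡ n ↑ʳ j → x ∉ coPair i j
  ⇒∉coPair = x∈p⇒x∉∁p ∘ ⇒x∈⁅y⁆∪⁅z⁆

  ∣coPair∣ : ∀ {c} (i : Fin n) (j : Fin m) → n + m ≡ 2 + c → ∣ coPair i j ∣ ≡ c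
  ∣coPair∣ i j n+m≡2+c = ∣p∣≡r⇒∣∁p∣≡c n+m≡2+c (⁅ i ↑ˡ m ⁆ ∪ ⁅ n ↑ʳ j ⁆) (∣⁅x⁆∪⁅y⁆∣≡2 (↑ˡ≢↑ʳ i j))

  coPair-injective : ∀ {i i′ : Fin n} {j j′ : Fin m} → coPair i j ≡ coPair i′ j′ → i ≡ i′ × j ≡ j′
  coPair-injective {i} {i′} {j} {j′} e
    with ∉coPair⇒ (subst (i ↑ˡ m ∉_) e (⇒∉coPair (inj₁ refl)))
       | ∉coPair⇒ (subst (n ↑ʳ j ∉_) e (⇒∉coPair (inj₂ refl)))
  ... | inj₁ l≡l′ | inj₂ r≡r′ = ↑ˡ-injective m i i′ l≡l′ , ↑ʳ-injective n j j′ r≡r′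
  ... | inj₂ l≡r′ | _         = ⊥-elim (↑ˡ≢↑ʳ i j′ l≡r′)
  ... | _         | inj₁ r≡l′ = ⊥-elim (↑ˡ≢↑ʳ i′ j (sym r≡l′))

  coPair-sd : ∀ {i i′ : Fin n} {j j′ : Fin m} → i′ ≢ i → j′ ≢ j →
    IsSuperDominating (Kb n m) (coPair i j)
  coPair-sd {i} {i′} {j} {j′} i′≢i j′≢j = IsSuperDominating-intro
    (λ x∉ → opposite (∉coPair⇒ x∉))
    (λ u∉ w∉ → one-per-side (∉coPair⇒ u∉) (∉coPair⇒ w∉))
    where
    ∈coPair : ∀ {x} → x ≢ i ↑ˡ m → x ≢ n ↑ʳ j → x ∈ coPair i j
    ∈coPair x≢l x≢r = x∉p⇒x∈∁p ([ x≢l , x≢r ]′ ∘ x∈⁅y⁆∪⁅z⁆⇒)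
    opposite : ∀ {x} → x ≡ i ↑ˡ m ⊎ x ≡ n ↑ʳ j → ∃ λ v → v ∈ coPair i j × side n v ≢ side n x
    opposite (inj₁ refl) = n ↑ʳ j′ , ∈coPair (↑ˡ≢↑ʳ i j′ ∘ sym) (j′≢j ∘ ↑ʳ-injective n j′ j) ,
                           side-↑ˡ≢side-↑ʳ i j′ ∘ sym
    opposite (inj₂ refl) = i′ ↑ˡ m , ∈coPair (i′≢i ∘ ↑ˡ-injective m i′ i) (↑ˡ≢↑ʳ i′ j) ,
                           side-↑ˡ≢side-↑ʳ i′ j
    one-per-side : ∀ {u w} → u ≡ i ↑ˡ m ⊎ u ≡ n ↑ʳ j → w ≡ i ↑ˡ m ⊎ w ≡ n ↑ʳ j →
      side n u ≡ side n w → u ≡ w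
    one-per-side (inj₁ refl) (inj₁ refl) _  = refl
    one-per-side (inj₂ refl) (inj₂ refl) _  = refl
    one-per-side (inj₁ refl) (inj₂ refl) su≡sw = ⊥-elim (side-↑ˡ≢side-↑ʳ i j su≡sw)
    one-per-side (inj₂ refl) (inj₁ refl) su≡sw = ⊥-elim (side-↑ˡ≢side-↑ʳ i j (sym su≡sw))

  ≡coPair : ∀ {S} {i : Fin n} {j : Fin m} → IsSuperDominating (Kb n m) S →
    i ↑ˡ m ∉ S → n ↑ʳ j ∉ S → S ≡ coPair i j
  ≡coPair {S} {i} {j} sdS l∉S r∉S = ≡∁-intro
    (λ {x} x∉S → ⇒x∈⁅y⁆∪⁅z⁆ (outside (part n x) x∉S))
    ([ (λ { refl → l∉S }) , (λ { refl → r∉S }) ]′ ∘ x∈⁅y⁆∪⁅z⁆⇒)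
    where
    outside : ∀ {x} → Part n m x → x ∉ S → x ≡ i ↑ˡ m ⊎ x ≡ n ↑ʳ j
    outside (left i′)  x∉S =
      inj₁ (one-outside-per-side sdS x∉S l∉S (trans (side-↑ˡ n i′) (sym (side-↑ˡ n i))))
    outside (right j′) x∉S =
      inj₂ (one-outside-per-side sdS x∉S r∉S (trans (side-↑ʳ n j′) (sym (side-↑ʳ n j))))

Nsp≡-completeBipartite : ∀ n m → 2 ≤ n → 2 ≤ m → Nsp≡ (Kb n m) (n * m)
Nsp≡-completeBipartite N@(suc (suc n)) M@(suc (suc m)) (s≤s (s≤s z≤n)) (s≤s (s≤s z≤n)) =
  Nsp≡-intro (Kb N M) f zero f-injective
    (λ _ → coPair-sd (punchInᵢ≢i _ zero) (punchInᵢ≢i _ zero))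
    (λ k → ∣coPair∣ (proj₁ (remQuot {N} M k)) (proj₂ (remQuot {N} M k)) refl)
    (λ T sdT → ∣∁p∣≤r⇒c≤∣p∣ refl T (∣∁T∣≤2 sdT)) upper
  where
  open Bipartite N M
  f : Fin (N * M) → Subset (N + M)
  f = uncurry coPair ∘ remQuot {N} M

  f-injective : Injective _≡_ _≡_ f
  f-injective {k} {k′} e = let (i≡i′ , j≡j′) = coPair-injective e in begin
    k                                    ≡⟨ sym (combine-remQuot {N} M k) ⟩
    uncurry combine (remQuot {N} M k)    ≡⟨ cong₂ combine i≡i′ j≡j′ ⟩
    uncurry combine (remQuot {N} M k′)   ≡⟨ combine-remQuot {N} M k′ ⟩
    k′                                   ∎
    where open ≡-Reasoning

  upper : ∀ S → IsSuperDominating (Kb N M) S → ∣ S ∣ ≤ n + M → ∃ λ k → f k ≡ S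
  upper S sdS ∣S∣≤c = oriented (part N (outside zero)) (part N (outside (suc zero)))
    (outside-∉ zero) (outside-∉ (suc zero)) (λ x≡y → case pick-injective (∁ S) 2≤∣∁S∣ x≡y of λ ())
    where
    2≤∣∁S∣ : 2 ≤ ∣ ∁ S ∣
    2≤∣∁S∣ = ∣p∣≤c⇒r≤∣∁p∣ refl S ∣S∣≤c
    outside : Fin 2 → Fin (N + M)
    outside = pick (∁ S) 2≤∣∁S∣
    outside-∉ : ∀ i → outside i ∉ S
    outside-∉ = x∈∁p⇒x∉p ∘ pick-∈ (∁ S) 2≤∣∁S∣
    fromCoPair : ∀ {i j} → i ↑ˡ M ∉ S → N ↑ʳ j ∉ S → ∃ λ k → f k ≡ S
    fromCoPair {i} {j} l∉S r∉S =
      combine i j , trans (cong (uncurry coPair) (remQuot-combine i j)) (sym (≡coPair sdS l∉S r∉S))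
    oriented : ∀ {u w} → Part N M u → Part N M w → u ∉ S → w ∉ S → u ≢ w → ∃ λ k → f k ≡ S
    oriented (left i)  (right j) l∉S r∉S _ = fromCoPair l∉S r∉S
    oriented (right j) (left i)  r∉S l∉S _ = fromCoPair l∉S r∉S
    oriented (left i)  (left i′) u∉S w∉S u≢w =
      ⊥-elim (u≢w (one-outside-per-side sdS u∉S w∉S (trans (side-↑ˡ N i) (sym (side-↑ˡ N i′)))))
    oriented (right j) (right j′) u∉S w∉S u≢w =
      ⊥-elim (u≢w (one-outside-per-side sdS u∉S w∉S (trans (side-↑ʳ N j) (sym (side-↑ʳ N j′)))))

centre∈ : ∀ {n T} (j : Fin n) → IsSuperDominating (Kb 1 n) T → suc j ∉ T → zero ∈ T
centre∈ j (dominating , _) leaf∉T with dominating (suc j) leaf∉T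
... | zero  , centre∈T , _ = centre∈T
... | suc _ , _        , adj = ⊥-elim (adj refl)

Nsp≡-star : ∀ n → Nsp≡ (Kb 1 n) (n + 1)
Nsp≡-star zero = Nsp≡-edgeless (Kb 1 0) λ { {zero} {zero} adj → adj refl }
Nsp≡-star (suc n) =
  subst (Nsp≡ (Kb 1 (suc n))) (+-comm 1 (suc n))
    (Nsp≡-coSingletons (Kb 1 (suc n)) neighbour atMostOneOutside)
  where
  open Bipartite 1 (suc n) using (one-outside-per-side)
  neighbour : ∀ u → ∃ λ v → Adj (Kb 1 (suc n)) v u
  neighbour zero    = suc zero , λ ()
  neighbour (suc _) = zero , λ ()
  atMostOneOutside : AtMostOneOutside (Kb 1 (suc n))
  atMostOneOutside T sdT {zero}  {zero}  _   _   = refl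
  atMostOneOutside T sdT {suc _} {suc _} u∉T w∉T = one-outside-per-side sdT u∉T w∉T refl
  atMostOneOutside T sdT {zero}  {suc j} u∉T w∉T = ⊥-elim (u∉T (centre∈ j sdT w∉T))
  atMostOneOutside T sdT {suc i} {zero}  u∉T w∉T = ⊥-elim (w∉T (centre∈ i sdT u∉T))

theorem6p1 : (∀ (n : ℕ) → 2 ≤ n → Nsp≡ (K n) n)
    × (∀ (n m : ℕ) → 2 ≤ n → 2 ≤ m → Nsp≡ (Kb n m) (n * m))
    × (∀ (n : ℕ) → Nsp≡ (Kb 1 n) (n + 1))
theorem6p1 = Nsp≡-complete , Nsp≡-completeBipartite , Nsp≡-star
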